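{- Let $\sigma=(r_1,\dots,r_k)$ be a composition of $n$ with $s_i=r_1+\cdots+r_i$. Let $\mathcal{H}_\sigma$ be the set of $n$-tuples $(p_1,\dots,p_n)\in\mathbb{N}^n$ whose nonzero entries appear in strictly increasing order from left to right and which satisfy $p_1,p_2,\dots,p_{s_i}\le s_i$ for every $i\in[k]$. For $x\in\mathcal{H}_\sigma$ let $S(x)\subseteq[n]$ be the set of positions of nonzero entries of $x$ and $T(x)\subseteq[n]$ the set of nonzero entries of $x$. Let $S,T\subseteq[n]$ with $\#S=\#T$ and let $R\subseteq[n]$ be disjoint from $S\cup T$. Then there exists $x\in\mathcal{H}_\sigma$ with $S(x)=S$ and $T(x)=T$ if and only if there exists $y\in\mathcal{H}_\sigma$ with $S(y)=S\cup R$ and $T(y)=T\cup R$.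
   Context: $\mathbb{N}=\{0,1,2,\dots\}$, $[n]=\{1,\dots,n\}$; a composition of $n$ is a sequence of positive integers with sum $n$. -}

module Defs where

open import Data.Nat using (ℕ; zero; suc; _+_; _<_; _≤_)
open import Data.Fin using (Fin; toℕ)
open import Data.Fin.Subset using (Subset; _∈_; _∉_; _∪_)
open import Data.List using (List; []; _∷_; map)
open import Data.Nat.ListAction using (sum)
open import Data.List.Relation.Unary.All using (All)
open import Data.Product using (Σ; _×_; ∃)
open import Relation.Nullary using (¬_)
open import Relation.Binary.PropositionalEquality using (_≡_; _≢_)
open import Function.Bundles using (_⇔_)

IsComposition : ℕ → List ℕ → Set
IsComposition n σ = All (λ r → 0 < r) σ × sum σ ≡ n

partialSums : List ℕ → List ℕ
partialSums [] = []
partialSums (r ∷ rs) = r ∷ map (r +_) (partialSums rs)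

-- An n-tuple (p_1,...,p_n) ∈ ℕ^n is a function Fin n → ℕ;
-- position i ∈ [n] corresponds to j : Fin n with toℕ j + 1 = i.
Tuple : ℕ → Set
Tuple n = Fin n → ℕ

NonzeroIncreasing : ∀ {n} → Tuple n → Set
NonzeroIncreasing {n} p =
  (i j : Fin n) → toℕ i < toℕ j → p i ≢ 0 → p j ≢ 0 → p i < p j

Bounded : ∀ {n} → List ℕ → Tuple n → Set
Bounded {n} σ p = All (λ s → (j : Fin n) → toℕ j < s → p j ≤ s) (partialSums σ)

InH : ∀ {n} → List ℕ → Tuple n → Set
InH σ p = NonzeroIncreasing p × Bounded σ p

-- Subsets of [n] are Subset n; element j : Fin n stands for toℕ j + 1.
-- S(x) = A : the positions of nonzero entries of x are exactly A
PositionsEq : ∀ {n} → Tuple n → Subset n → Set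
PositionsEq {n} x A = (j : Fin n) → (j ∈ A) ⇔ (x j ≢ 0)

ValuesEq : ∀ {n} → Tuple n → Subset n → Set
ValuesEq {n} x B = (j : Fin n) → (j ∈ B) ⇔ (∃ λ i → x i ≡ suc (toℕ j))

Disjoint : ∀ {n} → Subset n → Subset n → Set
Disjoint {n} R A = (j : Fin n) → j ∈ R → j ∉ A

{-# OPTIONS --safe #-}
-- When ∣ A ∣ ≡ ∣ B ∣, some x ∈ H_σ has positions A and values B iff, at every partial sum s
-- of σ, A has at most as many elements as B among the first s positions.  Necessity: the
-- nonzero entries in the first s positions are distinct, at most s, and lie in 1 + B.
-- Sufficiency: give the r-th position of A the value 1 + (the r-th element of B).  Adding R,
-- disjoint from A and B, adds the same count to both sides of each of these inequalities.
module Submission where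

open import Defs
open import Data.Nat using (ℕ; zero; suc; _+_; _≤_; _<_; z≤n; s≤s; s≤s⁻¹; z<s; s<s; _≟_)
open import Data.Nat.Properties
open import Data.Nat.ListAction using (sum)
open import Data.Fin using (Fin; zero; suc; toℕ; fromℕ<)
open import Data.Fin.Properties using (toℕ-injective; toℕ<n; toℕ-fromℕ<)
open import Data.Fin.Subset using (Subset; inside; outside; _∈_; _∉_; ∣_∣; _∪_)
open import Data.Fin.Subset.Properties using (_∈?_; x∈p∪q⁺)
open import Data.Vec using ([]; _∷_; here; there)
open import Data.List using (List; []; _∷_)
open import Data.List.Relation.Unary.All as All using (All; []; _∷_)
open import Data.List.Relation.Unary.All.Properties using (map⁺)
open import Data.Product using (Σ; _×_; _,_; ∃)
open import Data.Sum using (inj₁; inj₂)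
open import Function using (_∘_)
open import Function.Bundles using (_⇔_; mk⇔; Equivalence)
open import Function.Construct.Composition using (_⇔-∘_)
open import Function.Construct.Symmetry using (⇔-sym)
open import Relation.Nullary using (yes; no; contradiction)
open import Relation.Binary.PropositionalEquality
  using (_≡_; _≢_; refl; sym; trans; cong; cong₂; subst; subst₂; module ≡-Reasoning)

private variable
  n : ℕ
  σ : List ℕ
  A B R : Subset n

countBelow : Subset n → ℕ → ℕ
countBelow []            s       = 0
countBelow (b ∷ A)       zero    = 0
countBelow (inside ∷ A)  (suc s) = suc (countBelow A s)
countBelow (outside ∷ A) (suc s) = countBelow A s

countBelow-zero : (A : Subset n) → countBelow A 0 ≡ 0
countBelow-zero []      = refl
countBelow-zero (b ∷ A) = refl

countBelow-∈ : {j : Fin n} → j ∈ A → countBelow A (suc (toℕ j)) ≡ suc (countBelow A (toℕ j))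
countBelow-∈ {A = inside ∷ A}  here        = cong suc (countBelow-zero A)
countBelow-∈ {A = inside ∷ A}  (there j∈A) = cong suc (countBelow-∈ j∈A)
countBelow-∈ {A = outside ∷ A} (there j∈A) = countBelow-∈ j∈A

countBelow-∉ : (j : Fin n) → j ∉ A → countBelow A (suc (toℕ j)) ≡ countBelow A (toℕ j)
countBelow-∉ {A = inside ∷ A}  zero    j∉A = contradiction here j∉A
countBelow-∉ {A = outside ∷ A} zero    j∉A = countBelow-zero A
countBelow-∉ {A = inside ∷ A}  (suc j) j∉A = cong suc (countBelow-∉ j (j∉A ∘ there))
countBelow-∉ {A = outside ∷ A} (suc j) j∉A = countBelow-∉ j (j∉A ∘ there)

countBelow-mono : (A : Subset n) {s t : ℕ} → s ≤ t → countBelow A s ≤ countBelow A t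
countBelow-mono []            _         = z≤n
countBelow-mono (b ∷ A)       z≤n       = z≤n
countBelow-mono (inside ∷ A)  (s≤s s≤t) = s≤s (countBelow-mono A s≤t)
countBelow-mono (outside ∷ A) (s≤s s≤t) = countBelow-mono A s≤t

countBelow-full : (A : Subset n) → countBelow A n ≡ ∣ A ∣
countBelow-full []            = refl
countBelow-full (inside ∷ A)  = cong suc (countBelow-full A)
countBelow-full (outside ∷ A) = countBelow-full A

countBelow-<-∈ : (A : Subset n) {j : Fin n} {s : ℕ} → j ∈ A → toℕ j < s →
                 countBelow A (toℕ j) < countBelow A s
countBelow-<-∈ A j∈A j<s = subst (_≤ _) (countBelow-∈ j∈A) (countBelow-mono A j<s)

countBelow-<-∣∣ : (A : Subset n) {j : Fin n} → j ∈ A → countBelow A (toℕ j) < ∣ A ∣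
countBelow-<-∣∣ A {j} j∈A =
  subst (countBelow A (toℕ j) <_) (countBelow-full A) (countBelow-<-∈ A j∈A (toℕ<n j))

Disjoint-∷⁻ : ∀ {a r} → Disjoint (r ∷ R) (a ∷ A) → Disjoint R A
Disjoint-∷⁻ R#A j j∈R j∈A = R#A (suc j) (there j∈R) (there j∈A)

countBelow-∪ : Disjoint R A → (s : ℕ) → countBelow (A ∪ R) s ≡ countBelow A s + countBelow R s
countBelow-∪ {R = []}          {A = []}          _   s       = refl
countBelow-∪ {R = r ∷ R}       {A = a ∷ A}       _   zero    = refl
countBelow-∪ {R = inside ∷ R}  {A = inside ∷ A}  R#A (suc s) = contradiction here (R#A zero here)
countBelow-∪ {R = outside ∷ R} {A = inside ∷ A}  R#A (suc s) = cong suc (countBelow-∪ (Disjoint-∷⁻ R#A) s)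
countBelow-∪ {R = inside ∷ R}  {A = outside ∷ A} R#A (suc s) =
  trans (cong suc (countBelow-∪ (Disjoint-∷⁻ R#A) s)) (sym (+-suc _ _))
countBelow-∪ {R = outside ∷ R} {A = outside ∷ A} R#A (suc s) = countBelow-∪ (Disjoint-∷⁻ R#A) s

∣∪∣-disjoint : Disjoint R A → ∣ A ∪ R ∣ ≡ ∣ A ∣ + ∣ R ∣
∣∪∣-disjoint {R = R} {A = A} R#A = begin
  ∣ A ∪ R ∣                       ≡⟨ countBelow-full (A ∪ R) ⟨
  countBelow (A ∪ R) _            ≡⟨ countBelow-∪ R#A _ ⟩
  countBelow A _ + countBelow R _ ≡⟨ cong₂ _+_ (countBelow-full A) (countBelow-full R) ⟩
  ∣ A ∣ + ∣ R ∣                   ∎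
  where open ≡-Reasoning

-- The position of the r-th element (counting from 0) of B; junk for r ≥ ∣ B ∣.
nth : Subset n → ℕ → ℕ
nth []            r       = 0
nth (inside ∷ B)  zero    = 0
nth (inside ∷ B)  (suc r) = suc (nth B r)
nth (outside ∷ B) r       = suc (nth B r)

nth-< : (B : Subset n) {r s : ℕ} → r < countBelow B s → nth B r < s
nth-< (inside ∷ B)  {zero}  {suc s} _         = z<s
nth-< (inside ∷ B)  {suc r} {suc s} (s<s r<c) = s<s (nth-< B r<c)
nth-< (outside ∷ B) {r}     {suc s} r<c       = s<s (nth-< B r<c)

countBelow-nth : (B : Subset n) {r : ℕ} → r < ∣ B ∣ → countBelow B (nth B r) ≡ r
countBelow-nth (inside ∷ B)  {zero}  _           = refl
countBelow-nth (inside ∷ B)  {suc r} (s<s r<∣B∣) = cong suc (countBelow-nth B r<∣B∣)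
countBelow-nth (outside ∷ B) r<∣B∣               = countBelow-nth B r<∣B∣

nth-countBelow : {j : Fin n} → j ∈ B → nth B (countBelow B (toℕ j)) ≡ toℕ j
nth-countBelow {B = inside ∷ B}  here        = refl
nth-countBelow {B = inside ∷ B}  (there j∈B) = cong suc (nth-countBelow j∈B)
nth-countBelow {B = outside ∷ B} (there j∈B) = cong suc (nth-countBelow j∈B)

nth-∈ : (B : Subset n) {r : ℕ} → r < ∣ B ∣ → ∃ λ k → k ∈ B × toℕ k ≡ nth B r
nth-∈ (inside ∷ B) {zero} _ = zero , here , refl
nth-∈ (inside ∷ B) {suc r} (s<s r<∣B∣) with nth-∈ B r<∣B∣
... | k , k∈B , k≡ = suc k , there k∈B , cong suc k≡
nth-∈ (outside ∷ B) r<∣B∣ with nth-∈ B r<∣B∣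
... | k , k∈B , k≡ = suc k , there k∈B , cong suc k≡

nth-strictMono : (B : Subset n) {r r′ : ℕ} → r < r′ → r′ < ∣ B ∣ → nth B r < nth B r′
nth-strictMono B {r} r<r′ r′<∣B∣ = nth-< B (subst (r <_) (sym (countBelow-nth B r′<∣B∣)) r<r′)

Realisable : List ℕ → Subset n → Subset n → Set
Realisable {n} σ A B = Σ (Tuple n) λ x → InH σ x × PositionsEq x A × ValuesEq x B

DominatedAt : List ℕ → Subset n → Subset n → Set
DominatedAt σ A B = All (λ s → countBelow A s ≤ countBelow B s) (partialSums σ)

partialSums-≤-sum : (σ : List ℕ) → All (_≤ sum σ) (partialSums σ)
partialSums-≤-sum []      = []
partialSums-≤-sum (r ∷ σ) = m≤m+n r (sum σ) ∷ map⁺ (All.map (+-monoʳ-≤ r) (partialSums-≤-sum σ))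

nonzero-entry-∈ : {x : Tuple n} → ValuesEq x B → (i : Fin n) → x i ≢ 0 → x i ≤ n →
                  ∃ λ k → k ∈ B × x i ≡ suc (toℕ k)
nonzero-entry-∈ {x = x} values i xi≢0 xi≤n with x i in xi≡
... | zero  = contradiction refl xi≢0
... | suc w = k , Equivalence.from (values k) (i , trans xi≡ w≡k) , w≡k
  where
  k = fromℕ< xi≤n
  w≡k : suc w ≡ suc (toℕ k)
  w≡k = cong suc (sym (toℕ-fromℕ< xi≤n))

PrefixBound : Tuple n → ℕ → ℕ → Set
PrefixBound x s t = ∀ j → toℕ j < s → x j ≢ 0 → x j ≤ t

module _ {x : Tuple n} {A B : Subset n} (increasing : NonzeroIncreasing x)
         (positions : PositionsEq x A) (values : ValuesEq x B) where

  -- If the last position j is in A, its entry is 1 + k with k ∈ B and all earlier nonzero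
  -- entries are at most k; this is why the induction runs over every bound t, not just t = s.
  positions≤values-step : {s : ℕ} (j : Fin n) → toℕ j ≡ s →
    (∀ {t} → t ≤ n → PrefixBound x s t → countBelow A s ≤ countBelow B t) →
    ∀ {t} → t ≤ n → PrefixBound x (suc s) t → countBelow A (suc s) ≤ countBelow B t
  positions≤values-step j refl ih {t} t≤n bound with j ∈? A
  ... | no j∉A = begin
    countBelow A (suc (toℕ j)) ≡⟨ countBelow-∉ j j∉A ⟩
    countBelow A (toℕ j)       ≤⟨ ih t≤n (λ i i<j → bound i (m<n⇒m<1+n i<j)) ⟩
    countBelow B t             ∎
    where open ≤-Reasoning
  ... | yes j∈A = lastInA (nonzero-entry-∈ values j xj≢0 (≤-trans xj≤t t≤n))
    where
    open ≤-Reasoning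
    xj≢0 = Equivalence.to (positions j) j∈A
    xj≤t = bound j ≤-refl xj≢0
    lastInA : (∃ λ k → k ∈ B × x j ≡ suc (toℕ k)) → countBelow A (suc (toℕ j)) ≤ countBelow B t
    lastInA (k , k∈B , xj≡1+k) = begin
      countBelow A (suc (toℕ j)) ≡⟨ countBelow-∈ j∈A ⟩
      suc (countBelow A (toℕ j)) ≤⟨ s≤s (ih (<⇒≤ (toℕ<n k)) earlier≤k) ⟩
      suc (countBelow B (toℕ k)) ≡⟨ countBelow-∈ k∈B ⟨
      countBelow B (suc (toℕ k)) ≤⟨ countBelow-mono B (subst (_≤ t) xj≡1+k xj≤t) ⟩
      countBelow B t             ∎
      where
      earlier≤k : PrefixBound x (toℕ j) (toℕ k)
      earlier≤k i i<j xi≢0 = s≤s⁻¹ (subst (x i <_) xj≡1+k (increasing i j i<j xi≢0 xj≢0))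

  positions≤values : {s t : ℕ} → s ≤ n → t ≤ n → PrefixBound x s t → countBelow A s ≤ countBelow B t
  positions≤values {zero}  _   _ _ = subst (_≤ _) (sym (countBelow-zero A)) z≤n
  positions≤values {suc s} s<n =
    positions≤values-step (fromℕ< s<n) (toℕ-fromℕ< s<n) (positions≤values (<⇒≤ s<n))

realisable⇒dominated : {A B : Subset n} → IsComposition n σ → Realisable σ A B → DominatedAt σ A B
realisable⇒dominated {σ = σ} (_ , Σσ≡n) (_ , (increasing , bounded) , positions , values) =
  All.zipWith (λ (bound , s≤n) → positions≤values increasing positions values s≤n s≤n
                                   (λ j j<s _ → bound j j<s))
              (bounded , subst (λ m → All (_≤ m) (partialSums σ)) Σσ≡n (partialSums-≤-sum σ))

realisation : Subset n → Subset n → Tuple n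
realisation A B j with j ∈? A
... | yes _ = suc (nth B (countBelow A (toℕ j)))
... | no  _ = 0

realisation-∈ : (B : Subset n) {j : Fin n} → j ∈ A →
                realisation A B j ≡ suc (nth B (countBelow A (toℕ j)))
realisation-∈ {A = A} B {j} j∈A with j ∈? A
... | yes _   = refl
... | no  j∉A = contradiction j∈A j∉A

realisation-≢0 : (A B : Subset n) (j : Fin n) → realisation A B j ≢ 0 → j ∈ A
realisation-≢0 A B j xj≢0 with j ∈? A
... | yes j∈A = j∈A
... | no  _   = contradiction refl xj≢0

realisation-positions : (A B : Subset n) → PositionsEq (realisation A B) A
realisation-positions A B j =
  mk⇔ (λ j∈A → subst (_≢ 0) (sym (realisation-∈ B j∈A)) λ ()) (realisation-≢0 A B j)

realisation-bounded : (A B : Subset n) {s : ℕ} → countBelow A s ≤ countBelow B s →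
                      (j : Fin n) → toℕ j < s → realisation A B j ≤ s
realisation-bounded A B {s} dominatedAtS j j<s with realisation A B j ≟ 0
... | yes xj≡0 = subst (_≤ s) (sym xj≡0) z≤n
... | no  xj≢0 = subst (_≤ s) (sym (realisation-∈ B j∈A))
                   (nth-< B (≤-trans (countBelow-<-∈ A j∈A j<s) dominatedAtS))
  where j∈A = realisation-≢0 A B j xj≢0

module _ {A B : Subset n} (∣A∣≡∣B∣ : ∣ A ∣ ≡ ∣ B ∣) where

  private
    x = realisation A B

    rank<∣B∣ : {j : Fin n} → j ∈ A → countBelow A (toℕ j) < ∣ B ∣
    rank<∣B∣ j∈A = subst (_ <_) ∣A∣≡∣B∣ (countBelow-<-∣∣ A j∈A)

  realisation-increasing : NonzeroIncreasing (realisation A B)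
  realisation-increasing i j i<j xi≢0 xj≢0 =
    subst₂ _<_ (sym (realisation-∈ B i∈A)) (sym (realisation-∈ B j∈A))
      (s<s (nth-strictMono B (countBelow-<-∈ A i∈A i<j) (rank<∣B∣ j∈A)))
    where
    i∈A = realisation-≢0 A B i xi≢0
    j∈A = realisation-≢0 A B j xj≢0

  realisation-values : ValuesEq (realisation A B) B
  realisation-values j = mk⇔ hit value∈B
    where
    hit : j ∈ B → ∃ λ i → x i ≡ suc (toℕ j)
    hit j∈B = preimage (nth-∈ A r<∣A∣)
      where
      r = countBelow B (toℕ j)
      r<∣A∣ = subst (r <_) (sym ∣A∣≡∣B∣) (countBelow-<-∣∣ B j∈B)
      preimage : (∃ λ i → i ∈ A × toℕ i ≡ nth A r) → ∃ λ i → x i ≡ suc (toℕ j)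
      preimage (i , i∈A , i≡) = i , (begin
        x i                                  ≡⟨ realisation-∈ B i∈A ⟩
        suc (nth B (countBelow A (toℕ i)))   ≡⟨ cong (λ i → suc (nth B (countBelow A i))) i≡ ⟩
        suc (nth B (countBelow A (nth A r))) ≡⟨ cong (suc ∘ nth B) (countBelow-nth A r<∣A∣) ⟩
        suc (nth B r)                        ≡⟨ cong suc (nth-countBelow j∈B) ⟩
        suc (toℕ j)                          ∎)
        where open ≡-Reasoning
    value∈B : (∃ λ i → x i ≡ suc (toℕ j)) → j ∈ B
    value∈B (i , xi≡1+j) = index∈B (nth-∈ B (rank<∣B∣ i∈A))
      where
      i∈A = realisation-≢0 A B i (λ xi≡0 → 0≢1+n (trans (sym xi≡0) xi≡1+j))
      nth≡j : nth B (countBelow A (toℕ i)) ≡ toℕ j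
      nth≡j = suc-injective (trans (sym (realisation-∈ B i∈A)) xi≡1+j)
      index∈B : (∃ λ k → k ∈ B × toℕ k ≡ nth B (countBelow A (toℕ i))) → j ∈ B
      index∈B (k , k∈B , k≡) = subst (_∈ B) (toℕ-injective (trans k≡ nth≡j)) k∈B

  dominated⇒realisable : DominatedAt σ A B → Realisable σ A B
  dominated⇒realisable dominated =
    realisation A B ,
    (realisation-increasing , All.map (realisation-bounded A B) dominated) ,
    realisation-positions A B ,
    realisation-values

realisable⇔dominated : {A B : Subset n} → IsComposition n σ → ∣ A ∣ ≡ ∣ B ∣ →
                       Realisable σ A B ⇔ DominatedAt σ A B
realisable⇔dominated σ-composition ∣A∣≡∣B∣ =
  mk⇔ (realisable⇒dominated σ-composition) (dominated⇒realisable ∣A∣≡∣B∣)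

dominated⇔dominated-∪ : Disjoint R A → Disjoint R B →
                        DominatedAt σ A B ⇔ DominatedAt σ (A ∪ R) (B ∪ R)
dominated⇔dominated-∪ {R = R} R#A R#B = mk⇔
  (All.map λ {s} A≤B → subst₂ _≤_ (sym (countBelow-∪ R#A s)) (sym (countBelow-∪ R#B s))
                                  (+-monoˡ-≤ (countBelow R s) A≤B))
  (All.map λ {s} A∪R≤B∪R → +-cancelʳ-≤ (countBelow R s) _ _
                             (subst₂ _≤_ (countBelow-∪ R#A s) (countBelow-∪ R#B s) A∪R≤B∪R))

lemma2p1 : (n : ℕ) (σ : List ℕ) → IsComposition n σ →
    (S T R : Subset n) → ∣ S ∣ ≡ ∣ T ∣ → Disjoint R (S ∪ T) →
    (Σ (Tuple n) λ x → InH σ x × PositionsEq x S × ValuesEq x T)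
      ⇔ (Σ (Tuple n) λ y → InH σ y × PositionsEq y (S ∪ R) × ValuesEq y (T ∪ R))
lemma2p1 n σ σ-composition S T R ∣S∣≡∣T∣ R#S∪T =
  ⇔-sym (realisable⇔dominated σ-composition ∣S∪R∣≡∣T∪R∣)
    ⇔-∘ (dominated⇔dominated-∪ R#S R#T ⇔-∘ realisable⇔dominated σ-composition ∣S∣≡∣T∣)
  where
  R#S : Disjoint R S
  R#S j j∈R j∈S = R#S∪T j j∈R (x∈p∪q⁺ (inj₁ j∈S))
  R#T : Disjoint R T
  R#T j j∈R j∈T = R#S∪T j j∈R (x∈p∪q⁺ (inj₂ j∈T))
  ∣S∪R∣≡∣T∪R∣ : ∣ S ∪ R ∣ ≡ ∣ T ∪ R ∣
  ∣S∪R∣≡∣T∪R∣ = trans (∣∪∣-disjoint R#S) (trans (cong (_+ ∣ R ∣) ∣S∣≡∣T∣) (sym (∣∪∣-disjoint R#T)))
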